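{- For a permutation $\pi\in\mathfrak{S}_n$ of $\{1,\ldots,n\}$ write $\Phi_{\mathrm{dif}}(\pi)=\sum_{k=1}^{n-1}\frac{1}{\pi(k)-\pi(k+1)}$. Let $\sigma\in\mathfrak{S}_s$ and $\tau\in\mathfrak{S}_t$ be permutations of $\{1,\ldots,s\}$ and $\{1,\ldots,t\}$ respectively, such that $\sigma(s)=s$, $\tau(1)=1$, and $\Phi_{\mathrm{dif}}(\sigma)=\Phi_{\mathrm{dif}}(\tau)=0$. Define $\rho\in\mathfrak{S}_{s+t-1}$ by $$\rho(k)=\begin{cases}\sigma(k), & 1\leq k\leq s,\\ s-1+\tau(k-s+1), & s+1\leq k\leq s+t-1.\end{cases}$$ Then $\Phi_{\mathrm{dif}}(\rho)=0$. Furthermore, if $\tau(t)=t$, then $\rho(s+t-1)=s+t-1$.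
   Context: $\mathfrak{S}_n$ denotes the set of permutations $\pi=(\pi(1),\ldots,\pi(n))$ of $\{1,2,\ldots,n\}$. -}

module Defs where

open import Data.Nat as ℕ using (ℕ; zero; suc; _<?_; _≤?_; _∸_; _+_)
open import Data.Fin using (Fin; toℕ; fromℕ<)
open import Data.Fin.Permutation using (Permutation′; _⟨$⟩ʳ_)
open import Data.Integer as ℤ using (ℤ; +_; +[1+_]; -[1+_])
open import Data.Rational as ℚ using (ℚ; 0ℚ)
open import Relation.Nullary using (yes; no)

-- Value of a permutation π ∈ 𝔖_n at the 1-based position k, as a 1-based
-- value in {1,…,n}:  val π k = π(k).  (Out-of-range positions give 0;
-- they are never used in the statement.)
val : ∀ {n} → Permutation′ n → ℕ → ℕ
val {n} π zero = 0
val {n} π (suc j) with j <? n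
... | yes j<n = suc (toℕ (π ⟨$⟩ʳ fromℕ< j<n))
... | no _    = 0

-- The rational number 1/z for a nonzero integer z (with the harmless
-- convention 1/0 := 0, never used since permutations are injective).
recip : ℤ → ℚ
recip (+ zero)     = 0ℚ
recip +[1+ m ]     = ℚ._/_ (+ 1) (suc m)
recip -[1+ m ]     = ℚ._/_ -[1+ 0 ] (suc m)

sumFrom1 : ℕ → (ℕ → ℚ) → ℚ
sumFrom1 zero    f = 0ℚ
sumFrom1 (suc m) f = sumFrom1 m f ℚ.+ f (suc m)

Φdif : ℕ → (ℕ → ℕ) → ℚ
Φdif n f = sumFrom1 (n ∸ 1) (λ k → recip (+ f k ℤ.- + f (suc k)))

Φdifπ : ∀ {n} → Permutation′ n → ℚ
Φdifπ {n} π = Φdif n (val π)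

ρ : ∀ {s t} → Permutation′ s → Permutation′ t → ℕ → ℕ
ρ {s} {t} σ τ k with k ≤? s
... | yes _ = val σ k
... | no  _ = (s ∸ 1) + val τ ((k ∸ s) + 1)

{-# OPTIONS --safe #-}
module Submission where

open import Defs
open import Data.Nat using (ℕ; zero; suc; _+_; _∸_; _≤_; z≤n; s≤s; _≤?_)
open import Data.Nat.Properties
  using (≤-refl; m≤n⇒m≤1+n; +-suc; +-comm; m+n∸m≡n; m+1+n≰m)
open import Data.Fin.Permutation using (Permutation′)
import Data.Integer as ℤ
open import Data.Integer.Properties using (m-n≡m⊖n; +-cancelˡ-⊖)
open import Data.Rational as ℚ using (ℚ; 0ℚ)
open import Data.Rational.Properties using (+-assoc; +-identityʳ)
open import Data.Product using (_×_; _,_)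
open import Relation.Nullary using (yes; no; contradiction)
open import Relation.Binary.PropositionalEquality
open ≡-Reasoning

-- ρ agrees with σ on 1,…,s and with τ shifted up by s − 1 on s,…,s+t−1; the two
-- descriptions overlap at k = s because σ(s) = s = s − 1 + τ(1).  Differences of
-- consecutive values are invariant under the shift, so Φdif(ρ) = Φdif(σ) + Φdif(τ).

sumFrom1-cong : ∀ m (f g : ℕ → ℚ) → (∀ k → 1 ≤ k → k ≤ m → f k ≡ g k) →
                sumFrom1 m f ≡ sumFrom1 m g
sumFrom1-cong zero    f g f≗g = refl
sumFrom1-cong (suc m) f g f≗g = cong₂ ℚ._+_
  (sumFrom1-cong m f g (λ k 1≤k k≤m → f≗g k 1≤k (m≤n⇒m≤1+n k≤m)))
  (f≗g (suc m) (s≤s z≤n) ≤-refl)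

sumFrom1-+ : ∀ a b (f : ℕ → ℚ) →
             sumFrom1 (a + b) f ≡ sumFrom1 a f ℚ.+ sumFrom1 b (λ j → f (a + j))
sumFrom1-+ a zero    f rewrite +-comm a 0 = sym (+-identityʳ (sumFrom1 a f))
sumFrom1-+ a (suc b) f rewrite +-suc a b | sumFrom1-+ a b f = +-assoc (sumFrom1 a f) _ _

pos-+-cancelˡ : ∀ c x y → ℤ.+ (c + x) ℤ.- ℤ.+ (c + y) ≡ ℤ.+ x ℤ.- ℤ.+ y
pos-+-cancelˡ c x y = begin
  ℤ.+ (c + x) ℤ.- ℤ.+ (c + y) ≡⟨ m-n≡m⊖n (c + x) (c + y) ⟩
  (c + x) ℤ.⊖ (c + y)         ≡⟨ +-cancelˡ-⊖ c x y ⟩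
  x ℤ.⊖ y                     ≡⟨ m-n≡m⊖n x y ⟨
  ℤ.+ x ℤ.- ℤ.+ y             ∎

Φdif-cong : ∀ n (f g : ℕ → ℕ) → (∀ k → 1 ≤ k → k ≤ n → f k ≡ g k) →
            Φdif n f ≡ Φdif n g
Φdif-cong zero    f g f≗g = refl
Φdif-cong (suc n) f g f≗g = sumFrom1-cong n _ _ λ k 1≤k k≤n →
  cong recip (cong₂ (λ x y → ℤ.+ x ℤ.- ℤ.+ y)
    (f≗g k 1≤k (m≤n⇒m≤1+n k≤n)) (f≗g (suc k) (s≤s z≤n) (s≤s k≤n)))

Φdif-shift : ∀ n c (f : ℕ → ℕ) → Φdif n (λ k → c + f k) ≡ Φdif n f
Φdif-shift n c f = sumFrom1-cong (n ∸ 1) _ _ λ k _ _ →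
  cong recip (pos-+-cancelˡ c (f k) (f (suc k)))

Φdif-++ : ∀ a b (f : ℕ → ℕ) →
          Φdif (a + suc b) f ≡ Φdif (suc a) f ℚ.+ Φdif (suc b) (λ j → f (a + j))
Φdif-++ a b f = begin
  sumFrom1 (a + suc b ∸ 1) term         ≡⟨ cong (λ m → sumFrom1 (m ∸ 1) term) (+-suc a b) ⟩
  sumFrom1 (a + b) term                 ≡⟨ sumFrom1-+ a b term ⟩
  sumFrom1 a term ℚ.+ sumFrom1 b (λ j → term (a + j))
    ≡⟨ cong (sumFrom1 a term ℚ.+_) (sumFrom1-cong b _ _ λ j _ _ →
         cong (λ m → recip (ℤ.+ f (a + j) ℤ.- ℤ.+ f m)) (sym (+-suc a j))) ⟩
  Φdif (suc a) f ℚ.+ Φdif (suc b) (λ j → f (a + j)) ∎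
  where
  term : ℕ → ℚ
  term k = recip (ℤ.+ f k ℤ.- ℤ.+ f (suc k))

module _ {a t} (σ : Permutation′ (suc a)) (τ : Permutation′ t) where

  ρ-≤ : ∀ k → k ≤ suc a → ρ σ τ k ≡ val σ k
  ρ-≤ k k≤s with k ≤? suc a
  ... | yes _   = refl
  ... | no  k≰s = contradiction k≤s k≰s

  ρ-> : ∀ j → ρ σ τ (suc a + suc j) ≡ a + val τ (suc (suc j))
  ρ-> j with suc a + suc j ≤? suc a
  ... | yes k≤s = contradiction k≤s (m+1+n≰m (suc a))
  ... | no  _   = cong (λ i → a + val τ i) (begin
    (suc a + suc j ∸ suc a) + 1 ≡⟨ cong (_+ 1) (m+n∸m≡n (suc a) (suc j)) ⟩
    suc j + 1                   ≡⟨ +-comm (suc j) 1 ⟩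
    suc (suc j)                 ∎)

  ρ-glued : val σ (suc a) ≡ suc a → val τ 1 ≡ 1 →
            ∀ j → 1 ≤ j → ρ σ τ (a + j) ≡ a + val τ j
  ρ-glued σ-fix τ-fix (suc zero) _ = begin
    ρ σ τ (a + 1)   ≡⟨ cong (ρ σ τ) (+-comm a 1) ⟩
    ρ σ τ (suc a)   ≡⟨ ρ-≤ (suc a) ≤-refl ⟩
    val σ (suc a)   ≡⟨ σ-fix ⟩
    suc a           ≡⟨ +-comm 1 a ⟩
    a + 1           ≡⟨ cong (a +_) τ-fix ⟨
    a + val τ 1     ∎
  ρ-glued σ-fix τ-fix (suc (suc j)) _ = trans (cong (ρ σ τ) (+-suc a (suc j))) (ρ-> j)

lemma1 : (s t : ℕ) → 1 ≤ s → 1 ≤ t →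
    (σ : Permutation′ s) → (τ : Permutation′ t) →
    val σ s ≡ s → val τ 1 ≡ 1 →
    Φdifπ σ ≡ 0ℚ → Φdifπ τ ≡ 0ℚ →
    (Φdif (s + t ∸ 1) (ρ σ τ) ≡ 0ℚ)
      × (val τ t ≡ t → ρ σ τ (s + t ∸ 1) ≡ s + t ∸ 1)
lemma1 (suc a) (suc b) _ _ σ τ σ-fix τ-fix Φσ≡0 Φτ≡0 = Φρ≡0 , ρ-fix
  where
  Φρ≡0 : Φdif (a + suc b) (ρ σ τ) ≡ 0ℚ
  Φρ≡0 = begin
    Φdif (a + suc b) (ρ σ τ)
      ≡⟨ Φdif-++ a b (ρ σ τ) ⟩
    Φdif (suc a) (ρ σ τ) ℚ.+ Φdif (suc b) (λ j → ρ σ τ (a + j))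
      ≡⟨ cong₂ ℚ._+_ (Φdif-cong (suc a) _ _ λ k _ k≤s → ρ-≤ σ τ k k≤s)
                     (Φdif-cong (suc b) _ _ λ j 1≤j _ → ρ-glued σ τ σ-fix τ-fix j 1≤j) ⟩
    Φdifπ σ ℚ.+ Φdif (suc b) (λ j → a + val τ j)
      ≡⟨ cong (Φdifπ σ ℚ.+_) (Φdif-shift (suc b) a (val τ)) ⟩
    Φdifπ σ ℚ.+ Φdifπ τ
      ≡⟨ cong₂ ℚ._+_ Φσ≡0 Φτ≡0 ⟩
    0ℚ ℚ.+ 0ℚ
      ≡⟨ +-identityʳ 0ℚ ⟩
    0ℚ ∎

  ρ-fix : val τ (suc b) ≡ suc b → ρ σ τ (a + suc b) ≡ a + suc b
  ρ-fix τ-last = trans (ρ-glued σ τ σ-fix τ-fix (suc b) (s≤s z≤n)) (cong (a +_) τ-last)
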